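{- For integers $d\geq1$ and $k\geq2$, there exists a constant $C=C(k)$ such that the following holds. Let $G=G(V,E)$ be a tree with vertex set $V=\{v_1,v_2,\ldots,v_{k+1}\}$. If $A_1,A_2,\ldots,A_{k+1}\subseteq\mathbb{F}_q^d$ and $|A_i||A_j|\geq Cq^{d+k-1}$ for every $\{v_i,v_j\}\in E$, then $\Pi_G(A_1\times A_2\times\cdots\times A_{k+1})\supseteq(\mathbb{F}_q^*)^k$.
   Context: $\mathbb{F}_q$ is the finite field with $q$ elements, $\mathbb{F}_q^*=\mathbb{F}_q\setminus\{0\}$, and for $x,y\in\mathbb{F}_q^d$, $x\cdot y=\sum_{i=1}^d x_iy_i$. For a graph $G=(V,E)$ with $V=\{v_1,\ldots,v_n\}$ and $S\subseteq(\mathbb{F}_q^d)^n$, $\Pi_G(S)$ is the set of functions $\alpha:E\to\mathbb{F}_q$ (viewed as vectors in $(\mathbb{F}_q)^E$) such that there exists $(x_1,\ldots,x_n)\in S$ with $x_i\cdot x_j=\alpha(\{v_i,v_j\})$ for every $\{v_i,v_j\}\in E$. Since a tree on $k+1$ vertices has $k$ edges, $(\mathbb{F}_q^*)^k$ here denotes the set of functions $E\to\mathbb{F}_q^*$. -}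

module Defs where

open import Level using (0ℓ)
open import Data.Nat using (ℕ; suc; _≤_)
open import Data.Fin using (Fin)
open import Data.Vec using (Vec; zipWith; foldr)
open import Data.List using (List; _∷_; []; length; _++_; [_])
open import Data.List.Relation.Unary.Unique.Propositional using (Unique)
open import Data.List.Relation.Unary.Linked using (Linked)
open import Data.Product using (Σ; _×_; ∃; _,_)
open import Relation.Binary.PropositionalEquality using (_≡_)
open import Data.Empty using (⊥)
open import Relation.Nullary using (¬_)
open import Function.Bundles using (_↔_)
open import Algebra.Structures using (IsCommutativeRing)

record FiniteField (q : ℕ) : Set₁ where
  field
    Carrier : Set
    _+_ _*_ : Carrier → Carrier → Carrier
    -_ : Carrier → Carrier
    0# 1# : Carrier
    isCommutativeRing : IsCommutativeRing _≡_ _+_ _*_ -_ 0# 1#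
    0≢1 : ¬ (0# ≡ 1#)
    inverse : ∀ x → ¬ (x ≡ 0#) → Σ Carrier λ y → x * y ≡ 1#
    enumeration : Fin q ↔ Carrier

module _ {q : ℕ} (F : FiniteField q) where
  open FiniteField F

  dot : ∀ {d} → Vec Carrier d → Vec Carrier d → Carrier
  dot x y = foldr _ _+_ 0# (zipWith _*_ x y)

FinSubset : (A : Set) → Set
FinSubset A = Σ (List A) Unique

∣_∣ : ∀ {A : Set} → FinSubset A → ℕ
∣ (xs , _) ∣ = length xs

record Graph (n : ℕ) : Set₁ where
  field
    Adj : Fin n → Fin n → Set
    sym : ∀ {i j} → Adj i j → Adj j i
    irrefl : ∀ {i} → ¬ Adj i i

module _ {n : ℕ} (G : Graph n) where
  open Graph G

  data Reachable : Fin n → Fin n → Set where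
    here : ∀ {i} → Reachable i i
    step : ∀ {i j l} → Adj i j → Reachable j l → Reachable i l

  Connected : Set
  Connected = ∀ i j → Reachable i j

  IsCycle : List (Fin n) → Set
  IsCycle [] = ⊥
  IsCycle (v ∷ vs) = (3 ≤ length (v ∷ vs)) × Unique (v ∷ vs) × Linked Adj ((v ∷ vs) ++ [ v ])

  Acyclic : Set
  Acyclic = ∀ vs → ¬ IsCycle vs

  IsTree : Set
  IsTree = Connected × Acyclic

{-# OPTIONS --safe #-}
-- Fix t ≠ 0 and B ⊆ 𝔽_q^d, and let deg x be the number of y ∈ B with x · y = t. A hyperplane x · y = t
-- (y ≠ 0) has q^(d-1) points and two distinct ones meet in at most q^(d-2) points, so over 𝔽_q^d the sum of
-- deg is at least (|B| - 1) q^(d-1) and the sum of deg² at most |B| q^(d-1) + |B|² q^(d-2). Summing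
-- (q deg x - |B|)² ≥ 0 then leaves at most (q + 1) q^d / |B| points x with deg x = 0; hence when
-- |A| |B| ≥ 2 (q + 1) q^d at least half of A has a partner in B.
--
-- For a tree, remove a leaf ℓ with parent p and shrink A_p to the points with a partner in A_ℓ for the value
-- α(p, ℓ). This costs at most a factor 2 in the edge bounds, so the smaller tree is realized by induction, and
-- x_ℓ is chosen as a partner of x_p. After k leaves the requirement is 2^k · 2 (q + 1) q^d ≤ 4 · 2^k q^(d+k-1).
module Submission where

open import Defs
open import Data.Nat using (ℕ; zero; suc; _≤_; z≤n; s≤s)
open import Data.Fin using (Fin; zero; suc; punchIn; punchOut)
open import Data.Vec using (Vec; []; _∷_)
open import Data.List using (List; []; _∷_; length)
open import Data.List.Membership.Propositional using (_∈_)
open import Data.List.Relation.Unary.Any using (here; there)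
open import Data.List.Relation.Unary.Unique.Propositional using (Unique)
open import Data.Product using (Σ; ∃; _×_; _,_; proj₁; proj₂)
open import Relation.Binary.PropositionalEquality hiding ([_])
open import Relation.Nullary using (Dec; yes; no; ¬_; ¬?; contradiction)
open import Function using (_∘_)

module ListSums where
  open import Data.Nat using (_+_; _*_)
  open import Data.Nat.Properties hiding (_≟_)
  open import Algebra.Properties.CommutativeSemigroup +-commutativeSemigroup using (x∙yz≈y∙xz) renaming (interchange to +-interchange)
  open import Data.List using (map; filter; cartesianProductWith; _++_)
  open import Data.List.Relation.Binary.Subset.Propositional using (_⊆_)
  open import Data.List.Relation.Unary.All using (All; []; _∷_)
  import Data.List.Relation.Unary.All as All
  open import Data.List.Relation.Unary.All.Properties using (¬Any⇒All¬)
  open import Data.List.Relation.Unary.AllPairs using (_∷_)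
  open import Function using (id)
  open import Relation.Binary.Definitions using (DecidableEquality)
  open import Relation.Unary using (Decidable)

  private variable
    A B : Set
    P Q : Set

  𝟙 : Dec P → ℕ
  𝟙 (yes _) = 1
  𝟙 (no _) = 0

  𝟙-mono : (p : Dec P) (q : Dec Q) → (P → Q) → 𝟙 p ≤ 𝟙 q
  𝟙-mono (yes p) (yes _) _ = ≤-refl
  𝟙-mono (yes p) (no ¬q) f = contradiction (f p) ¬q
  𝟙-mono (no _) _ _ = z≤n

  𝟙-idem : (p : Dec P) → 𝟙 p * 𝟙 p ≡ 𝟙 p
  𝟙-idem (yes _) = refl
  𝟙-idem (no _) = refl

  ∑ : List A → (A → ℕ) → ℕ
  ∑ [] f = 0
  ∑ (x ∷ xs) f = f x + ∑ xs f

  syntax ∑ L (λ x → e) = ∑[ x ∈ L ] e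

  ∑-cong : ∀ (xs : List A) {f g} → (∀ x → f x ≡ g x) → ∑ xs f ≡ ∑ xs g
  ∑-cong [] eq = refl
  ∑-cong (x ∷ xs) eq = cong₂ _+_ (eq x) (∑-cong xs eq)

  ∑-mono : ∀ (xs : List A) {f g} → (∀ x → x ∈ xs → f x ≤ g x) → ∑ xs f ≤ ∑ xs g
  ∑-mono [] le = z≤n
  ∑-mono (x ∷ xs) le = +-mono-≤ (le x (here refl)) (∑-mono xs (λ y → le y ∘ there))

  ∑-+ : ∀ (xs : List A) (f g : A → ℕ) → ∑[ x ∈ xs ] (f x + g x) ≡ ∑ xs f + ∑ xs g
  ∑-+ [] f g = refl
  ∑-+ (x ∷ xs) f g = begin
    (f x + g x) + ∑[ y ∈ xs ] (f y + g y) ≡⟨ cong (f x + g x +_) (∑-+ xs f g) ⟩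
    (f x + g x) + (∑ xs f + ∑ xs g)       ≡⟨ +-interchange (f x) (g x) _ _ ⟩
    (f x + ∑ xs f) + (g x + ∑ xs g)       ∎
    where open ≡-Reasoning

  ∑-*ˡ : ∀ (xs : List A) c f → ∑[ x ∈ xs ] (c * f x) ≡ c * ∑ xs f
  ∑-*ˡ [] c f = sym (*-zeroʳ c)
  ∑-*ˡ (x ∷ xs) c f = trans (cong (c * f x +_) (∑-*ˡ xs c f)) (sym (*-distribˡ-+ c (f x) _))

  ∑-*ˡ² : ∀ (xs : List A) c f → ∑[ x ∈ xs ] (c * (c * f x)) ≡ c * (c * ∑ xs f)
  ∑-*ˡ² xs c f = trans (∑-*ˡ xs c (λ x → c * f x)) (cong (c *_) (∑-*ˡ xs c f))

  ∑-*ʳ : ∀ (xs : List A) c f → ∑[ x ∈ xs ] (f x * c) ≡ ∑ xs f * c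
  ∑-*ʳ xs c f = trans (∑-cong xs (λ x → *-comm (f x) c)) (trans (∑-*ˡ xs c f) (*-comm c _))

  ∑-*-∑ : ∀ (xs : List A) (ys : List B) f g → ∑ xs f * ∑ ys g ≡ ∑[ x ∈ xs ] ∑[ y ∈ ys ] (f x * g y)
  ∑-*-∑ xs ys f g = trans (sym (∑-*ʳ xs (∑ ys g) f)) (∑-cong xs (λ x → sym (∑-*ˡ ys (f x) g)))

  ∑-const : ∀ (xs : List A) c → ∑[ _ ∈ xs ] c ≡ length xs * c
  ∑-const [] c = refl
  ∑-const (x ∷ xs) c = cong (c +_) (∑-const xs c)

  ∑-++ : ∀ (xs ys : List A) f → ∑ (xs ++ ys) f ≡ ∑ xs f + ∑ ys f
  ∑-++ [] ys f = refl
  ∑-++ (x ∷ xs) ys f = trans (cong (f x +_) (∑-++ xs ys f)) (sym (+-assoc (f x) _ _))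

  ∑-map : ∀ (g : A → B) xs f → ∑ (map g xs) f ≡ ∑ xs (f ∘ g)
  ∑-map g [] f = refl
  ∑-map g (x ∷ xs) f = cong (f (g x) +_) (∑-map g xs f)

  ∑-comm : ∀ (xs : List A) (ys : List B) (f : A → B → ℕ) →
           ∑[ x ∈ xs ] ∑[ y ∈ ys ] f x y ≡ ∑[ y ∈ ys ] ∑[ x ∈ xs ] f x y
  ∑-comm [] ys f = sym (trans (∑-const ys 0) (*-zeroʳ (length ys)))
  ∑-comm (x ∷ xs) ys f = trans (cong (∑ ys (f x) +_) (∑-comm xs ys f)) (sym (∑-+ ys (f x) (λ y → ∑[ x′ ∈ xs ] f x′ y)))

  ∑-cartesianProductWith : ∀ {C : Set} (_∙_ : A → B → C) xs ys f →
    ∑ (cartesianProductWith _∙_ xs ys) f ≡ ∑[ x ∈ xs ] ∑[ y ∈ ys ] f (x ∙ y)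
  ∑-cartesianProductWith _∙_ [] ys f = refl
  ∑-cartesianProductWith _∙_ (x ∷ xs) ys f = begin
    ∑ (map (x ∙_) ys ++ cartesianProductWith _∙_ xs ys) f ≡⟨ ∑-++ (map (x ∙_) ys) _ f ⟩
    ∑ (map (x ∙_) ys) f + ∑ (cartesianProductWith _∙_ xs ys) f
      ≡⟨ cong₂ _+_ (∑-map (x ∙_) ys f) (∑-cartesianProductWith _∙_ xs ys f) ⟩
    ∑[ y ∈ ys ] f (x ∙ y) + ∑[ x′ ∈ xs ] ∑[ y ∈ ys ] f (x′ ∙ y) ∎
    where open ≡-Reasoning

  ∑-≥-const : ∀ (xs : List A) {g b} → (∀ y → y ∈ xs → b ≤ g y) → length xs * b ≤ ∑ xs g
  ∑-≥-const xs {b = b} lb = ≤-trans (≤-reflexive (sym (∑-const xs b))) (∑-mono xs lb)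

  ∑-≤-const : ∀ (xs : List A) {g b} → (∀ y → y ∈ xs → g y ≤ b) → ∑ xs g ≤ length xs * b
  ∑-≤-const xs {b = b} ub = ≤-trans (∑-mono xs ub) (≤-reflexive (∑-const xs b))

  module _ {A : Set} {P : A → Set} (P? : Decidable P) where

    ∑-𝟙*-none : ∀ {xs} (g : A → ℕ) → All (¬_ ∘ P) xs → ∑[ x ∈ xs ] (𝟙 (P? x) * g x) ≡ 0
    ∑-𝟙*-none g [] = refl
    ∑-𝟙*-none {x ∷ _} g (¬px ∷ ¬pxs) with P? x
    ... | yes px = contradiction px ¬px
    ... | no _ = ∑-𝟙*-none g ¬pxs

    ∑-𝟙-none : ∀ {xs} → All (¬_ ∘ P) xs → ∑[ x ∈ xs ] 𝟙 (P? x) ≡ 0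
    ∑-𝟙-none {xs} ¬pxs = trans (∑-cong xs (λ x → sym (*-identityʳ _))) (∑-𝟙*-none (λ _ → 1) ¬pxs)

    ∑-𝟙-singleton : ∀ {xs a} (g : A → ℕ) → Unique xs → a ∈ xs → P a → (∀ {x} → P x → x ≡ a) →
                    ∑[ x ∈ xs ] (𝟙 (P? x) * g x) ≡ g a
    ∑-𝟙-singleton {x ∷ xs} g (x∉xs ∷ _) _ _ only with P? x
    ... | yes px with refl ← only px =
      trans (cong₂ _+_ (+-identityʳ (g x)) (∑-𝟙*-none g (All.map (λ x≢y py → x≢y (sym (only py))) x∉xs)))
            (+-identityʳ (g x))
    ∑-𝟙-singleton {x ∷ xs} g (_ ∷ xs!) (here refl) pa only | no ¬px = contradiction pa ¬px
    ∑-𝟙-singleton {x ∷ xs} g (_ ∷ xs!) (there a∈xs) pa only | no ¬px = ∑-𝟙-singleton g xs! a∈xs pa only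

  module _ {A : Set} (_≟_ : DecidableEquality A) where

    ∑-𝟙-≡-≤1 : ∀ {xs} x → Unique xs → ∑[ y ∈ xs ] 𝟙 (x ≟ y) ≤ 1
    ∑-𝟙-≡-≤1 {xs} x xs! = ≤-trans (≤-reflexive (∑-cong xs (λ y → sym (*-identityʳ _)))) (bound (x ∈? xs))
      where
      open import Data.List.Membership.DecPropositional _≟_ using (_∈?_)
      bound : Dec (x ∈ xs) → ∑[ y ∈ xs ] (𝟙 (x ≟ y) * 1) ≤ 1
      bound (yes x∈xs) = ≤-reflexive (∑-𝟙-singleton (x ≟_) (λ _ → 1) xs! x∈xs refl sym)
      bound (no x∉xs) = ≤-trans (≤-reflexive (∑-𝟙*-none (x ≟_) (λ _ → 1) (¬Any⇒All¬ xs x∉xs))) z≤n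

    ∑-mono-⊆ : ∀ {xs ys} (h : A → ℕ) → Unique xs → Unique ys → xs ⊆ ys → ∑ xs h ≤ ∑ ys h
    ∑-mono-⊆ {xs} {ys} h xs! ys! xs⊆ys = begin
      ∑[ x ∈ xs ] h x
        ≤⟨ ∑-mono xs (λ x x∈xs → ≤-reflexive (sym (∑-𝟙-singleton (_≟ x) h ys! (xs⊆ys x∈xs) refl id))) ⟩
      ∑[ x ∈ xs ] ∑[ y ∈ ys ] (𝟙 (y ≟ x) * h y)
        ≡⟨ ∑-comm xs ys (λ x y → 𝟙 (y ≟ x) * h y) ⟩
      ∑[ y ∈ ys ] ∑[ x ∈ xs ] (𝟙 (y ≟ x) * h y)
        ≡⟨ ∑-cong ys (λ y → ∑-*ʳ xs (h y) (λ x → 𝟙 (y ≟ x))) ⟩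
      ∑[ y ∈ ys ] ((∑[ x ∈ xs ] 𝟙 (y ≟ x)) * h y)
        ≤⟨ ∑-mono ys (λ y _ → *-monoˡ-≤ (h y) (∑-𝟙-≡-≤1 y xs!)) ⟩
      ∑[ y ∈ ys ] (1 * h y)
        ≡⟨ ∑-cong ys (λ y → *-identityˡ (h y)) ⟩
      ∑[ y ∈ ys ] h y ∎
      where
      open ≤-Reasoning

    -- (length xs - 1) * b ≤ ∑ xs g and ∑ xs g ≤ a + (length xs - 1) * b, stated without truncated subtraction.
    ∑-≥-except : ∀ {xs} y₀ (g : A → ℕ) b → Unique xs → (∀ y → y ∈ xs → y ≢ y₀ → b ≤ g y) →
                 length xs * b ≤ ∑ xs g + b
    ∑-≥-except {[]} y₀ g b _ _ = z≤n
    ∑-≥-except {x ∷ xs} y₀ g b (x∉xs ∷ xs!) lb with x ≟ y₀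
    ... | yes refl = begin
      b + length xs * b  ≤⟨ +-monoʳ-≤ b (∑-≥-const xs (λ y y∈xs → lb y (there y∈xs) (x≢ y∈xs ∘ sym))) ⟩
      b + ∑ xs g         ≤⟨ +-monoʳ-≤ b (m≤n+m (∑ xs g) (g x)) ⟩
      b + (g x + ∑ xs g) ≡⟨ +-comm b _ ⟩
      g x + ∑ xs g + b   ∎
      where
      open ≤-Reasoning
      x≢ : ∀ {y} → y ∈ xs → x ≢ y
      x≢ = All.lookup x∉xs
    ... | no x≢y₀ = begin
      b + length xs * b    ≤⟨ +-mono-≤ (lb x (here refl) x≢y₀) (∑-≥-except y₀ g b xs! (λ y → lb y ∘ there)) ⟩
      g x + (∑ xs g + b)   ≡⟨ +-assoc (g x) _ _ ⟨
      g x + ∑ xs g + b     ∎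
      where open ≤-Reasoning

    ∑-≤-except : ∀ {xs y₀} (g : A → ℕ) a b → Unique xs → y₀ ∈ xs → g y₀ ≤ a →
                 (∀ y → y ∈ xs → y ≢ y₀ → g y ≤ b) → ∑ xs g + b ≤ a + length xs * b
    ∑-≤-except {x ∷ xs} {y₀} g a b (x∉xs ∷ xs!) y₀∈ ga ub with x ≟ y₀
    ... | yes refl = begin
      g x + ∑ xs g + b          ≤⟨ +-monoˡ-≤ b (+-monoʳ-≤ (g x)
                                     (∑-≤-const xs (λ y y∈xs → ub y (there y∈xs) (x≢ y∈xs ∘ sym)))) ⟩
      g x + length xs * b + b   ≤⟨ +-monoˡ-≤ b (+-monoˡ-≤ (length xs * b) ga) ⟩
      a + length xs * b + b     ≡⟨ +-assoc a _ b ⟩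
      a + (length xs * b + b)   ≡⟨ cong (a +_) (+-comm _ b) ⟩
      a + (b + length xs * b)   ∎
      where
      open ≤-Reasoning
      x≢ : ∀ {y} → y ∈ xs → x ≢ y
      x≢ = All.lookup x∉xs
    ... | no x≢y₀ = begin
      g x + ∑ xs g + b          ≡⟨ +-assoc (g x) _ _ ⟩
      g x + (∑ xs g + b)        ≤⟨ +-mono-≤ (ub x (here refl) x≢y₀)
                                             (∑-≤-except g a b xs! (y₀∈xs y₀∈) ga (λ y → ub y ∘ there)) ⟩
      b + (a + length xs * b)   ≡⟨ x∙yz≈y∙xz b a _ ⟩
      a + (b + length xs * b)   ∎
      where
      open ≤-Reasoning
      y₀∈xs : y₀ ∈ x ∷ xs → y₀ ∈ xs
      y₀∈xs (here refl) = contradiction refl x≢y₀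
      y₀∈xs (there y₀∈xs) = y₀∈xs

  module _ {A : Set} {P : A → Set} (P? : Decidable P) where

    length-filter+∑-𝟙-¬ : ∀ xs → length (filter P? xs) + ∑[ x ∈ xs ] 𝟙 (¬? (P? x)) ≡ length xs
    length-filter+∑-𝟙-¬ [] = refl
    length-filter+∑-𝟙-¬ (x ∷ xs) with P? x
    ... | yes _ = cong suc (length-filter+∑-𝟙-¬ xs)
    ... | no _ = trans (+-suc _ _) (cong suc (length-filter+∑-𝟙-¬ xs))

module FiniteTypes where
  open ListSums
  open import Data.Nat using (_*_; _^_)
  open import Data.Nat.Properties hiding (_≟_)
  import Data.Fin as Fin
  import Data.Vec.Properties as Vec
  open import Data.List using (map; allFin; cartesianProductWith)
  open import Data.List.Membership.Propositional.Properties using (∈-map⁺; ∈-allFin; ∈-cartesianProductWith⁺)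
  open import Data.List.Relation.Unary.All using ([])
  open import Data.List.Relation.Unary.AllPairs using ([]; _∷_)
  import Data.List.Relation.Unary.Unique.Propositional.Properties as Unique
  open import Function using (_↔_; Inverse; Injection)
  open import Function.Properties.Inverse using (↔-sym; Inverse⇒Injection)
  open import Relation.Binary.Definitions using (DecidableEquality)
  open import Relation.Nullary.Decidable using (via-injection)
  open import Relation.Unary using (Decidable)

  private variable
    A B : Set

  record Finite (X : Set) : Set where
    infix 4 _≟_
    field
      _≟_ : DecidableEquality X
      elements : List X
      elements-unique : Unique elements
      elements-complete : ∀ x → x ∈ elements

  Fin-finite : ∀ n → Finite (Fin n)
  Fin-finite n = record
    { _≟_ = Fin._≟_
    ; elements = allFin n
    ; elements-unique = Unique.allFin⁺ n
    ; elements-complete = ∈-allFin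
    }

  ↔-finite : A ↔ B → Finite A → Finite B
  ↔-finite A↔B FA = record
    { _≟_ = via-injection (Inverse⇒Injection (↔-sym A↔B)) _≟_
    ; elements = map to elements
    ; elements-unique = Unique.map⁺ (Injection.injective (Inverse⇒Injection A↔B)) elements-unique
    ; elements-complete = λ x → subst (_∈ map to elements) (strictlyInverseˡ x) (∈-map⁺ to (elements-complete (from x)))
    }
    where
    open Inverse A↔B
    open Finite FA

  module _ {A : Set} (FA : Finite A) where
    open Finite FA using (elements; elements-unique; elements-complete)

    ∑-𝟙-unique-solution : ∀ {P : A → Set} (P? : Decidable P) (g : A → ℕ) {a} → P a → (∀ {x} → P x → x ≡ a) →
                          ∑[ x ∈ elements ] (𝟙 (P? x) * g x) ≡ g a
    ∑-𝟙-unique-solution P? g {a} = ∑-𝟙-singleton P? g elements-unique (elements-complete a)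

    length-unique≤ : ∀ {xs} → Unique xs → length xs ≤ length elements
    length-unique≤ {xs} xs! = begin
      length xs        ≡⟨ length≡∑1 xs ⟩
      ∑[ _ ∈ xs ] 1    ≤⟨ ∑-mono-⊆ (Finite._≟_ FA) (λ _ → 1) xs! elements-unique (λ {x} _ → elements-complete x) ⟩
      ∑[ _ ∈ elements ] 1  ≡⟨ length≡∑1 elements ⟨
      length elements  ∎
      where
      open ≤-Reasoning
      length≡∑1 : ∀ ys → length ys ≡ ∑[ _ ∈ ys ] 1
      length≡∑1 ys = sym (trans (∑-const ys 1) (*-identityʳ (length ys)))

    vectors : ∀ d → List (Vec A d)
    vectors zero = [] ∷ []
    vectors (suc d) = cartesianProductWith _∷_ elements (vectors d)

    Vec-finite : ∀ d → Finite (Vec A d)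
    Vec-finite d = record
      { _≟_ = Vec.≡-dec (Finite._≟_ FA)
      ; elements = vectors d
      ; elements-unique = unique d
      ; elements-complete = complete d
      }
      where
      unique : ∀ d → Unique (vectors d)
      unique zero = [] ∷ []
      unique (suc d) = Unique.cartesianProductWith⁺ _∷_ Vec.∷-injective elements-unique (unique d)
      complete : ∀ d (v : Vec A d) → v ∈ vectors d
      complete zero [] = here refl
      complete (suc d) (a ∷ v) = ∈-cartesianProductWith⁺ _∷_ (elements-complete a) (complete d v)

    ∑-vectors-suc : ∀ d (h : Vec A (suc d) → ℕ) →
                    ∑ (vectors (suc d)) h ≡ ∑[ a ∈ elements ] ∑[ v ∈ vectors d ] h (a ∷ v)
    ∑-vectors-suc d = ∑-cartesianProductWith _∷_ elements (vectors d)

    ∑-vectors-const : ∀ d c → ∑[ _ ∈ vectors d ] c ≡ length elements ^ d * c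
    ∑-vectors-const zero c = refl
    ∑-vectors-const (suc d) c = begin
      ∑[ _ ∈ vectors (suc d) ] c                              ≡⟨ ∑-vectors-suc d (λ _ → c) ⟩
      ∑[ _ ∈ elements ] ∑[ _ ∈ vectors d ] c                  ≡⟨ ∑-cong elements (λ _ → ∑-vectors-const d c) ⟩
      ∑[ _ ∈ elements ] (length elements ^ d * c)             ≡⟨ ∑-const elements _ ⟩
      length elements * (length elements ^ d * c)             ≡⟨ *-assoc (length elements) _ c ⟨
      length elements ^ suc d * c                             ∎
      where open ≡-Reasoning

module NatInequalities where
  open ListSums using (𝟙)
  open import Data.Nat using (_+_; _*_; _∸_; _^_; NonZero)
  open import Data.Nat.Properties
  open import Data.Nat.Tactic.RingSolver using (solve-∀)
  open import Algebra.Properties.CommutativeSemigroup *-commutativeSemigroup using (x∙yz≈y∙xz; x∙yz≈yx∙z)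
  open import Data.Fin.Properties using () renaming (_≟_ to _≟ᶠ_)
  open import Data.Sum using (inj₁; inj₂)

  second-moment-arithmetic : ∀ {n q D X Y Z} →
    n * D ≤ X + D → Y + n * D ≤ n * (q * D + n * D) → Z * (n * n) + 2 * n * X ≤ Y + D * (n * n) →
    Z * (n * n) ≤ n * (q * D + D)
  second-moment-arithmetic {n} {q} {D} {X} {Y} {Z} first second pointwise =
    +-cancelʳ-≤ (2 * n * (n * D)) _ _ (begin
      Z * (n * n) + 2 * n * (n * D)                 ≤⟨ +-monoʳ-≤ (Z * (n * n)) (*-monoʳ-≤ (2 * n) first) ⟩
      Z * (n * n) + 2 * n * (X + D)                 ≡⟨ e₁ Z n X D ⟩
      (Z * (n * n) + 2 * n * X) + 2 * n * D         ≤⟨ +-monoˡ-≤ (2 * n * D) pointwise ⟩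
      (Y + D * (n * n)) + 2 * n * D                 ≡⟨ e₂ Y D n ⟩
      (Y + n * D) + (D * (n * n) + n * D)           ≤⟨ +-monoˡ-≤ _ second ⟩
      n * (q * D + n * D) + (D * (n * n) + n * D)   ≡⟨ e₃ n q D ⟩
      n * (q * D + D) + 2 * n * (n * D)             ∎)
    where
    open ≤-Reasoning
    e₁ : ∀ Z n X D → Z * (n * n) + 2 * n * (X + D) ≡ (Z * (n * n) + 2 * n * X) + 2 * n * D
    e₁ = solve-∀
    e₂ : ∀ Y D n → (Y + D * (n * n)) + 2 * n * D ≡ (Y + n * D) + (D * (n * n) + n * D)
    e₂ = solve-∀
    e₃ : ∀ n q D → n * (q * D + n * D) + (D * (n * n) + n * D) ≡ n * (q * D + D) + 2 * n * (n * D)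
    e₃ = solve-∀

  2mn≤m²+n² : ∀ m n → 2 * m * n ≤ m * m + n * n
  2mn≤m²+n² m n with ≤-total m n
  ... | inj₁ m≤n with k , refl ← m≤n⇒∃[o]m+o≡n m≤n = ≤-trans (m≤m+n _ (k * k)) (≤-reflexive (e m k))
    where
    e : ∀ m k → 2 * m * (m + k) + k * k ≡ m * m + (m + k) * (m + k)
    e = solve-∀
  ... | inj₂ n≤m with k , refl ← m≤n⇒∃[o]m+o≡n n≤m = ≤-trans (m≤m+n _ (k * k)) (≤-reflexive (e n k))
    where
    e : ∀ n k → 2 * (n + k) * n + k * k ≡ (n + k) * (n + k) + n * n
    e = solve-∀

  𝟙*n²+2na≤a²+n² : ∀ {P : Set} (p : Dec P) a n → (P → a ≡ 0) → 𝟙 p * (n * n) + 2 * n * a ≤ a * a + n * n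
  𝟙*n²+2na≤a²+n² (yes pa) a n a≡0 rewrite a≡0 pa = ≤-reflexive (e n)
    where
    e : ∀ n → 1 * (n * n) + 2 * n * 0 ≡ 0 * 0 + n * n
    e = solve-∀
  𝟙*n²+2na≤a²+n² (no _) a n _ = ≤-trans (2mn≤m²+n² n a) (≤-reflexive (+-comm (n * n) (a * a)))

  m+n≡o∧2n≤o⇒o≤2m : ∀ {m n o} → m + n ≡ o → 2 * n ≤ o → o ≤ 2 * m
  m+n≡o∧2n≤o⇒o≤2m {m} {n} refl 2n≤m+n = begin
    m + n      ≤⟨ +-monoʳ-≤ m (+-cancelʳ-≤ n n m (≤-trans (≤-reflexive (sym (e n))) 2n≤m+n)) ⟩
    m + m      ≡⟨ e m ⟨
    2 * m      ∎
    where
    open ≤-Reasoning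
    e : ∀ m → 2 * m ≡ m + m
    e m = cong (m +_) (+-identityʳ m)

  1≤2n⇒1≤n : ∀ {n} → 1 ≤ 2 * n → 1 ≤ n
  1≤2n⇒1≤n {suc n} _ = s≤s z≤n

  1≤m*n⇒1≤m : ∀ {m n} → 1 ≤ m * n → 1 ≤ m
  1≤m*n⇒1≤m {suc m} _ = s≤s z≤n

  size-halving : ∀ {m} {s s′ : Fin m → ℕ} {p i j} → s p ≤ 2 * s′ p → (∀ v → v ≢ p → s v ≡ s′ v) → i ≢ j →
                 s i * s j ≤ 2 * (s′ i * s′ j)
  size-halving {s = s} {s′} {p} {i} {j} half same i≢j with i ≟ᶠ p | j ≟ᶠ p
  ... | yes refl | yes refl = contradiction refl i≢j
  ... | yes refl | no j≢p rewrite same j j≢p =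
    ≤-trans (*-monoˡ-≤ (s′ j) half) (≤-reflexive (*-assoc 2 (s′ i) (s′ j)))
  ... | no i≢p | yes refl rewrite same i i≢p =
    ≤-trans (*-monoʳ-≤ (s′ i) half) (≤-reflexive (x∙yz≈y∙xz (s′ i) 2 (s′ j)))
  ... | no i≢p | no j≢p rewrite same i i≢p | same j j≢p = m≤n*m (s′ i * s′ j) 2

  -- K = 2 (q + 1) q^d is the edge bound needed by the pruning step and C = 4 · 2^k the constant of the theorem.
  2^k*K≤C*q^e : ∀ q d m .{{_ : NonZero q}} →
                2 ^ suc (suc m) * (2 * (q * q ^ d + q ^ d)) ≤ 4 * 2 ^ suc (suc m) * q ^ (d + suc (suc m) ∸ 1)
  2^k*K≤C*q^e q d m = begin
    2 ^ k * (2 * (q * q ^ d + q ^ d))       ≤⟨ *-monoʳ-≤ (2 ^ k) (*-monoʳ-≤ 2 (+-monoʳ-≤ (q * q ^ d) (m≤n*m (q ^ d) q))) ⟩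
    2 ^ k * (2 * (q ^ suc d + q ^ suc d))   ≡⟨ cong (λ n → 2 ^ k * (2 * (q ^ suc d + n))) (+-identityʳ (q ^ suc d)) ⟨
    2 ^ k * (2 * (2 * q ^ suc d))           ≡⟨ cong (2 ^ k *_) (*-assoc 2 2 (q ^ suc d)) ⟨
    2 ^ k * (4 * q ^ suc d)                 ≤⟨ *-monoʳ-≤ (2 ^ k) (*-monoʳ-≤ 4 (^-monoʳ-≤ q suc-d≤d+suc-m)) ⟩
    2 ^ k * (4 * q ^ (d + suc m))           ≡⟨ x∙yz≈yx∙z (2 ^ k) 4 _ ⟩
    4 * 2 ^ k * q ^ (d + suc m)             ≡⟨ cong (λ e → 4 * 2 ^ k * q ^ (e ∸ 1)) (+-suc d (suc m)) ⟨
    4 * 2 ^ k * q ^ (d + k ∸ 1)             ∎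
    where
    open ≤-Reasoning
    k : ℕ
    k = suc (suc m)
    suc-d≤d+suc-m : suc d ≤ d + suc m
    suc-d≤d+suc-m = ≤-trans (s≤s (m≤m+n d m)) (≤-reflexive (sym (+-suc d m)))

  K-positive : ∀ q d k .{{_ : NonZero q}} → 1 ≤ 2 ^ k * (2 * (q * q ^ d + q ^ d))
  K-positive q d k = begin
    1                                   ≤⟨ m^n>0 q d ⟩
    q ^ d                               ≤⟨ m≤n+m (q ^ d) (q * q ^ d) ⟩
    q * q ^ d + q ^ d                   ≤⟨ m≤n*m _ 2 ⟩
    2 * (q * q ^ d + q ^ d)             ≤⟨ m≤n*m _ (2 ^ k) {{m^n≢0 2 k}} ⟩
    2 ^ k * (2 * (q * q ^ d + q ^ d))   ∎
    where open ≤-Reasoning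

module FieldArithmetic {q : ℕ} (F : FiniteField q) where
  open FiniteTypes
  open import Level using (0ℓ)
  open import Data.Nat using (NonZero)
  open import Data.Fin.Properties using (nonZeroIndex)
  open import Function using (Inverse)
  open import Data.Vec using (replicate; zipWith; map)
  import Data.Vec.Properties as Vec
  open import Data.List using (allFin)
  open import Data.List.Properties using (length-map; length-tabulate)
  open import Algebra.Bundles using (CommutativeRing)
  open import Relation.Binary.Definitions using (DecidableEquality)
  open FiniteField F using (Carrier; isCommutativeRing; inverse; enumeration)

  commutativeRing : CommutativeRing 0ℓ 0ℓ
  commutativeRing = record { isCommutativeRing = isCommutativeRing }

  open CommutativeRing commutativeRing public using (_+_; _*_; -_; _-_; 0#; 1#)
  open CommutativeRing commutativeRing
    using (+-assoc; +-comm; +-identityˡ; +-identityʳ; -‿inverseˡ; -‿inverseʳ;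
           *-assoc; *-comm; *-identityˡ; *-identityʳ; distribˡ; zeroʳ;
           +-abelianGroup; ring; *-commutativeSemigroup; +-commutativeSemigroup)
  open import Algebra.Properties.AbelianGroup +-abelianGroup
    using (x∙y⁻¹≈ε⇒x≈y; x≈z//y; //-rightDividesˡ; ⁻¹-anti-homo‿-; ⁻¹-∙-comm)
  open import Algebra.Properties.Ring ring using (x[y-z]≈xy-xz; +-cancelʳ)
  open import Algebra.Properties.CommutativeSemigroup *-commutativeSemigroup using (x∙yz≈y∙xz)
  open import Algebra.Properties.CommutativeSemigroup +-commutativeSemigroup using () renaming (interchange to +-interchange)
  open ≡-Reasoning

  q-nonZero : NonZero q
  q-nonZero = nonZeroIndex (Inverse.from enumeration (FiniteField.0# F))

  scalars : Finite Carrier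
  scalars = ↔-finite enumeration (Fin-finite q)

  infix 4 _≟ᵛ_
  _≟ᵛ_ : ∀ {d} → DecidableEquality (Vec Carrier d)
  _≟ᵛ_ = Vec.≡-dec (Finite._≟_ scalars)

  length-scalars : length (Finite.elements scalars) ≡ q
  length-scalars = trans (length-map _ (allFin q)) (length-tabulate _)

  *-cancelˡ-≢0 : ∀ {c a b} → c ≢ 0# → c * a ≡ c * b → a ≡ b
  *-cancelˡ-≢0 {c} {a} {b} c≢0 eq = begin
    a               ≡⟨ *-identityˡ a ⟨
    1# * a          ≡⟨ cong (_* a) c⁻¹c≡1 ⟨
    (c⁻¹ * c) * a   ≡⟨ *-assoc c⁻¹ c a ⟩
    c⁻¹ * (c * a)   ≡⟨ cong (c⁻¹ *_) eq ⟩
    c⁻¹ * (c * b)   ≡⟨ *-assoc c⁻¹ c b ⟨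
    (c⁻¹ * c) * b   ≡⟨ cong (_* b) c⁻¹c≡1 ⟩
    1# * b          ≡⟨ *-identityˡ b ⟩
    b               ∎
    where
    c⁻¹ : Carrier
    c⁻¹ = proj₁ (inverse c c≢0)
    c⁻¹c≡1 : c⁻¹ * c ≡ 1#
    c⁻¹c≡1 = trans (*-comm c⁻¹ c) (proj₂ (inverse c c≢0))

  *-cancelʳ-≢0 : ∀ {c a b} → c ≢ 0# → a * c ≡ b * c → a ≡ b
  *-cancelʳ-≢0 {c} {a} {b} c≢0 eq = *-cancelˡ-≢0 c≢0 (trans (*-comm c a) (trans eq (*-comm b c)))

  linear-solution : ∀ {c} → c ≢ 0# → ∀ u s → Σ Carrier λ a → a * c + u ≡ s
  linear-solution {c} c≢0 u s = (s - u) * c⁻¹ , (begin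
    (s - u) * c⁻¹ * c + u     ≡⟨ cong (_+ u) (*-assoc (s - u) c⁻¹ c) ⟩
    (s - u) * (c⁻¹ * c) + u   ≡⟨ cong (λ e → (s - u) * e + u) (trans (*-comm c⁻¹ c) (proj₂ (inverse c c≢0))) ⟩
    (s - u) * 1# + u          ≡⟨ cong (_+ u) (*-identityʳ (s - u)) ⟩
    (s - u) + u               ≡⟨ //-rightDividesˡ u s ⟩
    s                         ∎)
    where
    c⁻¹ : Carrier
    c⁻¹ = proj₁ (inverse c c≢0)

  linear-unique : ∀ {c a b u s} → c ≢ 0# → a * c + u ≡ s → b * c + u ≡ s → a ≡ b
  linear-unique {u = u} c≢0 ha hb = *-cancelʳ-≢0 c≢0 (+-cancelʳ u _ _ (trans ha (sym hb)))

  [x-z]-[y-z]≡x-y : ∀ x y z → (x - z) - (y - z) ≡ x - y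
  [x-z]-[y-z]≡x-y x y z = begin
    (x - z) - (y - z)       ≡⟨ cong ((x - z) +_) (⁻¹-anti-homo‿- y z) ⟩
    (x - z) + (z - y)       ≡⟨ +-assoc x (- z) (z - y) ⟩
    x + (- z + (z - y))     ≡⟨ cong (x +_) (+-assoc (- z) z (- y)) ⟨
    x + ((- z + z) - y)     ≡⟨ cong (λ w → x + (w - y)) (-‿inverseˡ z) ⟩
    x + (0# - y)            ≡⟨ cong (x +_) (+-identityˡ (- y)) ⟩
    x - y                   ∎

  [w-x]+[y-z]≡[w+y]-[x+z] : ∀ w x y z → (w - x) + (y - z) ≡ (w + y) - (x + z)
  [w-x]+[y-z]≡[w+y]-[x+z] w x y z = trans (+-interchange w (- x) y (- z)) (cong ((w + y) +_) (⁻¹-∙-comm x z))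

  eliminate : ∀ {a c c′ u u′ t} → a * c + u ≡ t → a * c′ + u′ ≡ t → c′ * u - c * u′ ≡ c′ * t - c * t
  eliminate {a} {c} {c′} {u} {u′} {t} hu hu′ = begin
    c′ * u - c * u′                          ≡⟨ cong₂ (λ v v′ → c′ * v - c * v′) (solve-u hu) (solve-u hu′) ⟩
    c′ * (t - a * c) - c * (t - a * c′)      ≡⟨ cong₂ _-_ (x[y-z]≈xy-xz c′ t (a * c)) (x[y-z]≈xy-xz c t (a * c′)) ⟩
    (c′ * t - c′ * (a * c)) - (c * t - c * (a * c′))  ≡⟨ cong (λ v → (c′ * t - c′ * (a * c)) - (c * t - v)) swap ⟩
    (c′ * t - c′ * (a * c)) - (c * t - c′ * (a * c))  ≡⟨ [x-z]-[y-z]≡x-y (c′ * t) (c * t) (c′ * (a * c)) ⟩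
    c′ * t - c * t                           ∎
    where
    solve-u : ∀ {c u} → a * c + u ≡ t → u ≡ t - a * c
    solve-u {c} {u} h = x≈z//y u (a * c) t (trans (+-comm u (a * c)) h)
    swap : c * (a * c′) ≡ c′ * (a * c)
    swap = trans (x∙yz≈y∙xz c a c′) (trans (cong (a *_) (*-comm c c′)) (sym (x∙yz≈y∙xz c′ a c)))

  0ᵛ : ∀ {d} → Vec Carrier d
  0ᵛ = replicate _ 0#

  infixl 7 _·ᵛ_
  infixl 6 _-ᵛ_

  _·ᵛ_ : ∀ {d} → Carrier → Vec Carrier d → Vec Carrier d
  e ·ᵛ v = map (e *_) v

  _-ᵛ_ : ∀ {d} → Vec Carrier d → Vec Carrier d → Vec Carrier d
  _-ᵛ_ = zipWith _-_

  dot-0ᵛ : ∀ {d} (x : Vec Carrier d) → dot F x 0ᵛ ≡ 0#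
  dot-0ᵛ [] = refl
  dot-0ᵛ (a ∷ x) = trans (cong₂ _+_ (zeroʳ a) (dot-0ᵛ x)) (+-identityʳ 0#)

  dot-comm : ∀ {d} (x y : Vec Carrier d) → dot F x y ≡ dot F y x
  dot-comm [] [] = refl
  dot-comm (a ∷ x) (b ∷ y) = cong₂ _+_ (*-comm a b) (dot-comm x y)

  dot-·ᵛ : ∀ {d} e (x v : Vec Carrier d) → dot F x (e ·ᵛ v) ≡ e * dot F x v
  dot-·ᵛ e [] [] = sym (zeroʳ e)
  dot-·ᵛ e (a ∷ x) (b ∷ v) = begin
    a * (e * b) + dot F x (e ·ᵛ v)   ≡⟨ cong₂ _+_ (x∙yz≈y∙xz a e b) (dot-·ᵛ e x v) ⟩
    e * (a * b) + e * dot F x v      ≡⟨ distribˡ e (a * b) _ ⟨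
    e * (a * b + dot F x v)          ∎

  dot--ᵛ : ∀ {d} (x u v : Vec Carrier d) → dot F x (u -ᵛ v) ≡ dot F x u - dot F x v
  dot--ᵛ [] [] [] = sym (-‿inverseʳ 0#)
  dot--ᵛ (a ∷ x) (b ∷ u) (c ∷ v) = begin
    a * (b - c) + dot F x (u -ᵛ v)                   ≡⟨ cong₂ _+_ (x[y-z]≈xy-xz a b c) (dot--ᵛ x u v) ⟩
    (a * b - a * c) + (dot F x u - dot F x v)        ≡⟨ [w-x]+[y-z]≡[w+y]-[x+z] (a * b) (a * c) _ _ ⟩
    (a * b + dot F x u) - (a * c + dot F x v)        ∎

  ·ᵛ-cancel-≢0 : ∀ {d c} {u v : Vec Carrier d} → c ≢ 0# → c ·ᵛ u -ᵛ c ·ᵛ v ≡ 0ᵛ → u ≡ v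
  ·ᵛ-cancel-≢0 {u = []} {[]} c≢0 eq = refl
  ·ᵛ-cancel-≢0 {c = c} {a ∷ u} {b ∷ v} c≢0 eq =
    cong₂ _∷_ (*-cancelˡ-≢0 c≢0 (x∙y⁻¹≈ε⇒x≈y (c * a) (c * b) (Vec.∷-injectiveˡ eq)))
              (·ᵛ-cancel-≢0 c≢0 (Vec.∷-injectiveʳ eq))

  a*0+u≡u : ∀ a u → a * 0# + u ≡ u
  a*0+u≡u a u = trans (cong (_+ u) (zeroʳ a)) (+-identityˡ u)

  eliminated-trivial : ∀ {d c c′ t} {ys ys′ : Vec Carrier d} → t ≢ 0# → c ≢ 0# →
                       c′ ·ᵛ ys -ᵛ c ·ᵛ ys′ ≡ 0ᵛ → c′ * t - c * t ≡ 0# → c ∷ ys ≡ c′ ∷ ys′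
  eliminated-trivial {c = c} {c′} {t} t≢0 c≢0 w≡0 r≡0
    with refl ← *-cancelʳ-≢0 t≢0 (x∙y⁻¹≈ε⇒x≈y (c′ * t) (c * t) r≡0) = cong (c ∷_) (·ᵛ-cancel-≢0 c≢0 w≡0)

-- Point counts are multiplied by powers of q rather than compared with q^(d-1) or q^(d-2),
-- which avoids truncated subtraction in the exponent.
module HyperplaneCounts {q : ℕ} (F : FiniteField q) where
  open ListSums
  open FiniteTypes
  open import Data.Nat as ℕ using (_^_)
  open import Data.Nat.Properties hiding (_≟_)
  import Data.List.Relation.Unary.All as All
  open FiniteField F using (Carrier)
  open FieldArithmetic F
  open Finite scalars using (_≟_)

  𝔽 : List Carrier
  𝔽 = Finite.elements scalars

  𝔽^ : ∀ d → List (Vec Carrier d)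
  𝔽^ = vectors scalars

  solutions : ∀ {d} → Vec Carrier d → Carrier → ℕ
  solutions {d} y s = ∑[ x ∈ 𝔽^ d ] 𝟙 (dot F x y ≟ s)

  ∑-𝔽^-const : ∀ d c → ∑[ _ ∈ 𝔽^ d ] c ≡ q ^ d ℕ.* c
  ∑-𝔽^-const d c = trans (∑-vectors-const scalars d c) (cong (λ n → n ^ d ℕ.* c) length-scalars)

  ∑-𝔽-𝟙-linear : ∀ {c} → c ≢ 0# → ∀ u s → ∑[ a ∈ 𝔽 ] 𝟙 (a * c + u ≟ s) ≡ 1
  ∑-𝔽-𝟙-linear {c} c≢0 u s = trans (∑-cong 𝔽 (λ a → sym (*-identityʳ _)))
    (∑-𝟙-unique-solution scalars (λ a → a * c + u ≟ s) (λ _ → 1) (proj₂ sol) (λ h → linear-unique c≢0 h (proj₂ sol)))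
    where
    sol : Σ Carrier λ a → a * c + u ≡ s
    sol = linear-solution c≢0 u s

  ∑-𝔽-const : ∀ c → ∑[ _ ∈ 𝔽 ] c ≡ q ℕ.* c
  ∑-𝔽-const c = trans (∑-const 𝔽 c) (cong (ℕ._* c) length-scalars)

  solutions-0∷ : ∀ {d} (ys : Vec Carrier d) s → solutions (0# ∷ ys) s ≡ q ℕ.* solutions ys s
  solutions-0∷ {d} ys s = begin
    solutions (0# ∷ ys) s                                   ≡⟨ ∑-vectors-suc scalars d _ ⟩
    ∑[ a ∈ 𝔽 ] ∑[ xs ∈ 𝔽^ d ] 𝟙 (a * 0# + dot F xs ys ≟ s)
      ≡⟨ ∑-cong 𝔽 (λ a → ∑-cong (𝔽^ d) (λ xs → cong (λ v → 𝟙 (v ≟ s)) (a*0+u≡u a _))) ⟩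
    ∑[ _ ∈ 𝔽 ] solutions ys s                               ≡⟨ ∑-𝔽-const _ ⟩
    q ℕ.* solutions ys s                                    ∎
    where open ≡-Reasoning

  q*solutions≡q^d : ∀ {d} (y : Vec Carrier d) → y ≢ 0ᵛ → ∀ s → q ℕ.* solutions y s ≡ q ^ d
  q*solutions≡q^d [] y≢0 s = contradiction refl y≢0
  q*solutions≡q^d {suc d} (c ∷ ys) y≢0 s with c ≟ 0#
  ... | no c≢0 = cong (q ℕ.*_) (begin
    solutions (c ∷ ys) s                                   ≡⟨ ∑-vectors-suc scalars d _ ⟩
    ∑[ a ∈ 𝔽 ] ∑[ xs ∈ 𝔽^ d ] 𝟙 (a * c + dot F xs ys ≟ s)  ≡⟨ ∑-comm 𝔽 (𝔽^ d) _ ⟩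
    ∑[ xs ∈ 𝔽^ d ] ∑[ a ∈ 𝔽 ] 𝟙 (a * c + dot F xs ys ≟ s)
      ≡⟨ ∑-cong (𝔽^ d) (λ xs → ∑-𝔽-𝟙-linear c≢0 (dot F xs ys) s) ⟩
    ∑[ xs ∈ 𝔽^ d ] 1                                        ≡⟨ ∑-𝔽^-const d 1 ⟩
    q ^ d ℕ.* 1                                             ≡⟨ *-identityʳ (q ^ d) ⟩
    q ^ d                                                   ∎)
    where open ≡-Reasoning
  ... | yes refl = begin
    q ℕ.* solutions (0# ∷ ys) s      ≡⟨ cong (q ℕ.*_) (solutions-0∷ ys s) ⟩
    q ℕ.* (q ℕ.* solutions ys s)     ≡⟨ cong (q ℕ.*_) (q*solutions≡q^d ys (y≢0 ∘ cong (0# ∷_)) s) ⟩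
    q ℕ.* q ^ d                      ∎
    where open ≡-Reasoning

  solutions-0ᵛ : ∀ {d r} → r ≢ 0# → solutions {d} 0ᵛ r ≡ 0
  solutions-0ᵛ {d} {r} r≢0 =
    ∑-𝟙-none (λ x → dot F x 0ᵛ ≟ r) {𝔽^ d} (All.tabulate (λ {x} _ x·0≡r → r≢0 (trans (sym x·0≡r) (dot-0ᵛ x))))

  q*solutions≤q^d : ∀ {d} (w : Vec Carrier d) r → ¬ (w ≡ 0ᵛ × r ≡ 0#) → q ℕ.* solutions w r ≤ q ^ d
  q*solutions≤q^d {d} w r nontrivial with w ≟ᵛ 0ᵛ | r ≟ 0#
  ... | no w≢0 | _ = ≤-reflexive (q*solutions≡q^d w w≢0 r)
  ... | yes refl | no r≢0 = ≤-trans (≤-reflexive (trans (cong (q ℕ.*_) (solutions-0ᵛ {d} r≢0)) (*-zeroʳ q))) z≤n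
  ... | yes w≡0 | yes r≡0 = contradiction (w≡0 , r≡0) nontrivial

  common : ∀ {d} → Carrier → Vec Carrier d → Vec Carrier d → ℕ
  common {d} t y y′ = ∑[ x ∈ 𝔽^ d ] (𝟙 (dot F x y ≟ t) ℕ.* 𝟙 (dot F x y′ ≟ t))

  common-comm : ∀ {d} t (y y′ : Vec Carrier d) → common t y y′ ≡ common t y′ y
  common-comm {d} t y y′ = ∑-cong (𝔽^ d) (λ x → *-comm (𝟙 (dot F x y ≟ t)) _)

  common-0∷ : ∀ {d} t (ys ys′ : Vec Carrier d) → common t (0# ∷ ys) (0# ∷ ys′) ≡ q ℕ.* common t ys ys′
  common-0∷ {d} t ys ys′ = begin
    common t (0# ∷ ys) (0# ∷ ys′)                ≡⟨ ∑-vectors-suc scalars d _ ⟩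
    ∑[ a ∈ 𝔽 ] ∑[ xs ∈ 𝔽^ d ] (𝟙 (a * 0# + dot F xs ys ≟ t) ℕ.* 𝟙 (a * 0# + dot F xs ys′ ≟ t))
      ≡⟨ ∑-cong 𝔽 (λ a → ∑-cong (𝔽^ d) (λ xs →
           cong₂ (λ v v′ → 𝟙 (v ≟ t) ℕ.* 𝟙 (v′ ≟ t)) (a*0+u≡u a _) (a*0+u≡u a _))) ⟩
    ∑[ _ ∈ 𝔽 ] common t ys ys′                    ≡⟨ ∑-𝔽-const _ ⟩
    q ℕ.* common t ys ys′                         ∎
    where open ≡-Reasoning

  -- For fixed xs the first equation determines a; substituting it into the second leaves a
  -- single linear equation for xs.
  common-≤-eliminated : ∀ {d c c′ t} {ys ys′ : Vec Carrier d} → c ≢ 0# →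
                        common t (c ∷ ys) (c′ ∷ ys′) ≤ solutions (c′ ·ᵛ ys -ᵛ c ·ᵛ ys′) (c′ * t - c * t)
  common-≤-eliminated {d} {c} {c′} {t} {ys} {ys′} c≢0 = begin
    common t (c ∷ ys) (c′ ∷ ys′)
      ≡⟨ ∑-vectors-suc scalars d _ ⟩
    ∑[ a ∈ 𝔽 ] ∑[ xs ∈ 𝔽^ d ] (𝟙 (a * c + u xs ≟ t) ℕ.* 𝟙 (a * c′ + u′ xs ≟ t))
      ≡⟨ ∑-comm 𝔽 (𝔽^ d) _ ⟩
    ∑[ xs ∈ 𝔽^ d ] ∑[ a ∈ 𝔽 ] (𝟙 (a * c + u xs ≟ t) ℕ.* 𝟙 (a * c′ + u′ xs ≟ t))
      ≡⟨ ∑-cong (𝔽^ d) (λ xs → ∑-𝟙-unique-solution scalars (λ a → a * c + u xs ≟ t)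
                                 (λ a → 𝟙 (a * c′ + u′ xs ≟ t))
                                 (proj₂ (a₀ xs)) (λ ha → linear-unique c≢0 ha (proj₂ (a₀ xs)))) ⟩
    ∑[ xs ∈ 𝔽^ d ] 𝟙 (proj₁ (a₀ xs) * c′ + u′ xs ≟ t)
      ≤⟨ ∑-mono (𝔽^ d) (λ xs _ → 𝟙-mono _ _ (λ h → trans (dot-eliminated xs) (eliminate (proj₂ (a₀ xs)) h))) ⟩
    solutions (c′ ·ᵛ ys -ᵛ c ·ᵛ ys′) (c′ * t - c * t) ∎
    where
    open ≤-Reasoning
    u u′ : Vec Carrier d → Carrier
    u xs = dot F xs ys
    u′ xs = dot F xs ys′
    a₀ : ∀ xs → Σ Carrier λ a → a * c + u xs ≡ t
    a₀ xs = linear-solution c≢0 (u xs) t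
    dot-eliminated : ∀ xs → dot F xs (c′ ·ᵛ ys -ᵛ c ·ᵛ ys′) ≡ c′ * u xs - c * u′ xs
    dot-eliminated xs = trans (dot--ᵛ xs (c′ ·ᵛ ys) (c ·ᵛ ys′)) (cong₂ _-_ (dot-·ᵛ c′ xs ys) (dot-·ᵛ c xs ys′))

  q²*common≤q^d-eliminated : ∀ {d t c c′} {ys ys′ : Vec Carrier d} → t ≢ 0# → c ≢ 0# → c ∷ ys ≢ c′ ∷ ys′ →
                     q ℕ.* (q ℕ.* common t (c ∷ ys) (c′ ∷ ys′)) ≤ q ^ suc d
  q²*common≤q^d-eliminated {d} {t} {c} {c′} {ys} {ys′} t≢0 c≢0 y≢y′ = *-monoʳ-≤ q (begin
    q ℕ.* common t (c ∷ ys) (c′ ∷ ys′)  ≤⟨ *-monoʳ-≤ q (common-≤-eliminated c≢0) ⟩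
    q ℕ.* solutions (c′ ·ᵛ ys -ᵛ c ·ᵛ ys′) (c′ * t - c * t)
      ≤⟨ q*solutions≤q^d _ _ (λ (w≡0 , r≡0) → y≢y′ (eliminated-trivial t≢0 c≢0 w≡0 r≡0)) ⟩
    q ^ d ∎)
    where open ≤-Reasoning

  q²*common≤q^d : ∀ {t} → t ≢ 0# → ∀ {d} (y y′ : Vec Carrier d) → y ≢ y′ →
                  q ℕ.* (q ℕ.* common t y y′) ≤ q ^ d
  q²*common≤q^d t≢0 [] [] y≢y′ = contradiction refl y≢y′
  q²*common≤q^d {t} t≢0 {suc d} (c ∷ ys) (c′ ∷ ys′) y≢y′ with c ≟ 0# | c′ ≟ 0#
  ... | no c≢0 | _ = q²*common≤q^d-eliminated t≢0 c≢0 y≢y′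
  ... | yes _ | no c′≢0 = subst (λ n → q ℕ.* (q ℕ.* n) ≤ q ^ suc d) (common-comm t (c′ ∷ ys′) (c ∷ ys))
                                (q²*common≤q^d-eliminated t≢0 c′≢0 (y≢y′ ∘ sym))
  ... | yes refl | yes refl = begin
    q ℕ.* (q ℕ.* common t (0# ∷ ys) (0# ∷ ys′))   ≡⟨ cong (λ n → q ℕ.* (q ℕ.* n)) (common-0∷ t ys ys′) ⟩
    q ℕ.* (q ℕ.* (q ℕ.* common t ys ys′))
      ≤⟨ *-monoʳ-≤ q (q²*common≤q^d t≢0 ys ys′ (y≢y′ ∘ cong (0# ∷_))) ⟩
    q ℕ.* q ^ d                                     ∎
    where open ≤-Reasoning

module SecondMoment {q : ℕ} (F : FiniteField q) {d : ℕ} {t : FiniteField.Carrier F} (t≢0 : t ≢ FiniteField.0# F)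
                    (B : List (Vec (FiniteField.Carrier F) d)) (B! : Unique B) where
  open ListSums
  open FiniteTypes
  open NatInequalities
  open import Data.Nat using (_+_; _*_; _^_; NonZero)
  open import Data.Nat.Properties hiding (_≟_)
  open import Data.Nat.Tactic.RingSolver using (solve-∀)
  open import Data.List using (filter)
  open import Data.List.Relation.Unary.Any using (Any; any?)
  open import Data.List.Relation.Unary.All.Properties using (¬Any⇒All¬)
  open FiniteField F using (Carrier)
  open FieldArithmetic F using (scalars; 0ᵛ; _≟ᵛ_)
  open Finite scalars using (_≟_)
  open HyperplaneCounts F

  partner? : ∀ x → Dec (Any (λ y → dot F x y ≡ t) B)
  partner? x = any? (λ y → dot F x y ≟ t) B

  degree : Vec Carrier d → ℕ
  degree x = ∑[ y ∈ B ] 𝟙 (dot F x y ≟ t)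

  isolated : ℕ
  isolated = ∑[ x ∈ 𝔽^ d ] 𝟙 (¬? (partner? x))

  n D : ℕ
  n = length B
  D = q ^ d

  first-moment : n * D ≤ q * ∑ (𝔽^ d) degree + D
  first-moment = begin
    n * D                               ≤⟨ ∑-≥-except _≟ᵛ_ 0ᵛ (λ y → q * solutions y t) D B!
                                             (λ y _ y≢0 → ≤-reflexive (sym (q*solutions≡q^d y y≢0 t))) ⟩
    ∑[ y ∈ B ] (q * solutions y t) + D  ≡⟨ cong (_+ D) (∑-*ˡ B q (λ y → solutions y t)) ⟩
    q * ∑[ y ∈ B ] solutions y t + D    ≡⟨ cong (λ m → q * m + D) (∑-comm B (𝔽^ d) _) ⟩
    q * ∑ (𝔽^ d) degree + D ∎
    where open ≤-Reasoning

  ∑-degree² : ∑[ x ∈ 𝔽^ d ] (degree x * degree x) ≡ ∑[ y ∈ B ] ∑[ y′ ∈ B ] common t y y′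
  ∑-degree² = begin
    ∑[ x ∈ 𝔽^ d ] (degree x * degree x)
      ≡⟨ ∑-cong (𝔽^ d) (λ x → ∑-*-∑ B B (λ y → 𝟙 (dot F x y ≟ t)) (λ y′ → 𝟙 (dot F x y′ ≟ t))) ⟩
    ∑[ x ∈ 𝔽^ d ] ∑[ y ∈ B ] ∑[ y′ ∈ B ] (𝟙 (dot F x y ≟ t) * 𝟙 (dot F x y′ ≟ t))
      ≡⟨ ∑-comm (𝔽^ d) B _ ⟩
    ∑[ y ∈ B ] ∑[ x ∈ 𝔽^ d ] ∑[ y′ ∈ B ] (𝟙 (dot F x y ≟ t) * 𝟙 (dot F x y′ ≟ t))
      ≡⟨ ∑-cong B (λ y → ∑-comm (𝔽^ d) B _) ⟩
    ∑[ y ∈ B ] ∑[ y′ ∈ B ] common t y y′ ∎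
    where open ≡-Reasoning

  q²*∑-common≤ : ∀ {y} → y ∈ B → q * (q * ∑[ y′ ∈ B ] common t y y′) + D ≤ q * D + n * D
  q²*∑-common≤ {y} y∈B = begin
    q * (q * ∑[ y′ ∈ B ] common t y y′) + D   ≡⟨ cong (_+ D) (∑-*ˡ² B q (common t y)) ⟨
    ∑[ y′ ∈ B ] (q * (q * common t y y′)) + D ≤⟨ ∑-≤-except _≟ᵛ_ _ (q * D) D B! y∈B diagonal off-diagonal ⟩
    q * D + n * D                             ∎
    where
    open ≤-Reasoning
    diagonal : q * (q * common t y y) ≤ q * D
    diagonal = *-monoʳ-≤ q (≤-trans (≤-reflexive (cong (q *_) (∑-cong (𝔽^ d) (λ x → 𝟙-idem (dot F x y ≟ t)))))
                                    (q*solutions≤q^d y t (λ (_ , t≡0) → t≢0 t≡0)))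
    off-diagonal : ∀ y′ → y′ ∈ B → y′ ≢ y → q * (q * common t y y′) ≤ D
    off-diagonal y′ _ y′≢y = q²*common≤q^d t≢0 y y′ (y′≢y ∘ sym)

  second-moment : q * (q * ∑[ x ∈ 𝔽^ d ] (degree x * degree x)) + n * D ≤ n * (q * D + n * D)
  second-moment = begin
    q * (q * ∑[ x ∈ 𝔽^ d ] (degree x * degree x)) + n * D
      ≡⟨ cong₂ _+_ (trans (cong (λ m → q * (q * m)) ∑-degree²) (sym (∑-*ˡ² B q _))) (sym (∑-const B D)) ⟩
    ∑[ y ∈ B ] (q * (q * ∑[ y′ ∈ B ] common t y y′)) + ∑[ _ ∈ B ] D
      ≡⟨ ∑-+ B _ _ ⟨
    ∑[ y ∈ B ] (q * (q * ∑[ y′ ∈ B ] common t y y′) + D)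
      ≤⟨ ∑-≤-const B (λ _ → q²*∑-common≤) ⟩
    n * (q * D + n * D) ∎
    where open ≤-Reasoning

  isolated⇒degree≡0 : ∀ x → ¬ Any (λ y → dot F x y ≡ t) B → degree x ≡ 0
  isolated⇒degree≡0 x no-partner = ∑-𝟙-none (λ y → dot F x y ≟ t) (¬Any⇒All¬ B no-partner)

  isolated-moment : isolated * (n * n) + 2 * n * (q * ∑ (𝔽^ d) degree) ≤
                    q * (q * ∑[ x ∈ 𝔽^ d ] (degree x * degree x)) + D * (n * n)
  isolated-moment = begin
    isolated * (n * n) + 2 * n * (q * ∑ (𝔽^ d) degree)
      ≡⟨ cong₂ _+_ (∑-*ʳ (𝔽^ d) (n * n) _)
                   (trans (∑-*ˡ (𝔽^ d) (2 * n) _) (cong (2 * n *_) (∑-*ˡ (𝔽^ d) q degree))) ⟨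
    ∑[ x ∈ 𝔽^ d ] (𝟙 (¬? (partner? x)) * (n * n)) + ∑[ x ∈ 𝔽^ d ] (2 * n * (q * degree x))
      ≡⟨ ∑-+ (𝔽^ d) _ _ ⟨
    ∑[ x ∈ 𝔽^ d ] (𝟙 (¬? (partner? x)) * (n * n) + 2 * n * (q * degree x))
      ≤⟨ ∑-mono (𝔽^ d) (λ x _ → 𝟙*n²+2na≤a²+n² (¬? (partner? x)) (q * degree x) n
                                 (λ no-partner → trans (cong (q *_) (isolated⇒degree≡0 x no-partner)) (*-zeroʳ q))) ⟩
    ∑[ x ∈ 𝔽^ d ] ((q * degree x) * (q * degree x) + n * n)
      ≡⟨ ∑-+ (𝔽^ d) _ _ ⟩
    ∑[ x ∈ 𝔽^ d ] ((q * degree x) * (q * degree x)) + ∑[ _ ∈ 𝔽^ d ] (n * n)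
      ≡⟨ cong₂ _+_ (trans (∑-cong (𝔽^ d) (λ x → [qa][qa]≡q[q[aa]] q (degree x))) (∑-*ˡ² (𝔽^ d) q _))
                   (∑-𝔽^-const d (n * n)) ⟩
    q * (q * ∑[ x ∈ 𝔽^ d ] (degree x * degree x)) + D * (n * n) ∎
    where
    open ≤-Reasoning
    [qa][qa]≡q[q[aa]] : ∀ q a → (q * a) * (q * a) ≡ q * (q * (a * a))
    [qa][qa]≡q[q[aa]] = solve-∀

  isolated*n≤ : .{{NonZero n}} → isolated * n ≤ q * D + D
  isolated*n≤ = *-cancelʳ-≤ (isolated * n) (q * D + D) n (begin
    isolated * n * n    ≡⟨ *-assoc isolated n n ⟩
    isolated * (n * n)  ≤⟨ second-moment-arithmetic {n} {q} {D} {Z = isolated} first-moment second-moment isolated-moment ⟩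
    n * (q * D + D)     ≡⟨ *-comm n _ ⟩
    (q * D + D) * n     ∎)
    where open ≤-Reasoning

  half-have-partners : .{{NonZero n}} → ∀ {A} → Unique A → 2 * (q * D + D) ≤ length A * n →
                       length A ≤ 2 * length (filter partner? A)
  half-have-partners {A} A! big =
    m+n≡o∧2n≤o⇒o≤2m {n = unpartnered} (length-filter+∑-𝟙-¬ partner? A) (*-cancelʳ-≤ (2 * unpartnered) (length A) n (begin
    2 * unpartnered * n       ≡⟨ *-assoc 2 unpartnered n ⟩
    2 * (unpartnered * n)     ≤⟨ *-monoʳ-≤ 2 (*-monoˡ-≤ n unpartnered≤isolated) ⟩
    2 * (isolated * n)        ≤⟨ *-monoʳ-≤ 2 isolated*n≤ ⟩
    2 * (q * D + D)           ≤⟨ big ⟩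
    length A * n              ∎))
    where
    open ≤-Reasoning
    unpartnered : ℕ
    unpartnered = ∑[ x ∈ A ] 𝟙 (¬? (partner? x))
    unpartnered≤isolated : unpartnered ≤ isolated
    unpartnered≤isolated = ∑-mono-⊆ _≟ᵛ_ _ A! (Finite.elements-unique (Vec-finite scalars d))
                                     (λ {x} _ → Finite.elements-complete (Vec-finite scalars d) x)

module Walks {n : ℕ} (G : Graph n) where
  open FiniteTypes
  open import Data.Nat using (_+_; _<_)
  open import Data.Nat.Properties using (≤-trans; ≤-reflexive; <⇒≱; +-suc; m<m+n)
  open import Data.Fin.Properties using (any?) renaming (_≟_ to _≟ᶠ_)
  open import Data.List using (_++_; [_])
  open import Data.List.Properties using (length-tabulate)
  open import Data.List.Membership.DecPropositional (_≟ᶠ_ {n}) using (_∈?_)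
  open import Data.List.Relation.Binary.Subset.Propositional using (_⊆_)
  open import Data.List.Relation.Unary.All using ([]; _∷_)
  import Data.List.Relation.Unary.All as All
  open import Data.List.Relation.Unary.All.Properties using (¬Any⇒All¬)
  open import Data.List.Relation.Unary.AllPairs using ([]; _∷_)
  open import Data.List.Relation.Unary.Linked using (Linked; [-]; _∷_)
  open import Relation.Nullary.Decidable using (_×-dec_)
  open Graph G renaming (sym to Adj-sym)

  vertices : ∀ {i j} → Reachable G i j → List (Fin n)
  vertices {i} here = [ i ]
  vertices {i} (step _ r) = i ∷ vertices r

  Simple : ∀ {i j} → Reachable G i j → Set
  Simple r = Unique (vertices r)

  SimpleWalk : Fin n → Fin n → Set
  SimpleWalk i j = Σ (Reachable G i j) Simple

  first-step : ∀ {i j} → Reachable G i j → i ≢ j → ∃ (Adj i)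
  first-step here i≢i = contradiction refl i≢i
  first-step (step a _) _ = _ , a

  vertices-++-linked : ∀ {i j k} (r : Reachable G i j) → Adj j k → Linked Adj (vertices r ++ [ k ])
  vertices-++-linked here a = a ∷ [-]
  vertices-++-linked (step a here) a′ = a ∷ a′ ∷ [-]
  vertices-++-linked (step a r@(step _ _)) a′ = a ∷ vertices-++-linked r a′

  2≤length-vertices : ∀ {i j} (r : Reachable G i j) → i ≢ j → 2 ≤ length (vertices r)
  2≤length-vertices here i≢j = contradiction refl i≢j
  2≤length-vertices (step _ here) _ = s≤s (s≤s z≤n)
  2≤length-vertices (step _ (step _ _)) _ = s≤s (s≤s z≤n)

  suffix : ∀ {i m j} (r : Reachable G m j) → Simple r → i ∈ vertices r → SimpleWalk i j
  suffix here r! (here refl) = here , r!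
  suffix (step a r) r! (here refl) = step a r , r!
  suffix (step a r) (_ ∷ r!) (there i∈r) = suffix r r! i∈r

  simplify : ∀ {i j} → Reachable G i j → SimpleWalk i j
  simplify here = here , [] ∷ []
  simplify {i} (step a r) with simplify r
  ... | r′ , r′! with i ∈? vertices r′
  ...   | yes i∈r′ = suffix r′ r′! i∈r′
  ...   | no i∉r′ = step a r′ , ¬Any⇒All¬ _ i∉r′ ∷ r′!

  prefix : ∀ {i j k} (r : Reachable G i k) → Simple r → j ∈ vertices r →
           Σ (SimpleWalk i j) λ (r′ , _) → vertices r′ ⊆ vertices r
  prefix here r! (here refl) = (here , r!) , λ x → x
  prefix (step a r) r! (here refl) = (here , [] ∷ []) , λ { (here refl) → here refl }
  prefix (step a r) (i∉r ∷ r!) (there j∈r) with prefix r r! j∈r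
  ... | (r′ , r′!) , r′⊆r = (step a r′ , All.tabulate (λ x∈r′ → All.lookup i∉r (r′⊆r x∈r′)) ∷ r′!) , λ where
    (here refl) → here refl
    (there x∈r′) → there (r′⊆r x∈r′)

  module _ (acyclic : Acyclic G) where

    no-closing-edge : ∀ {i j} (r : Reachable G i j) → Simple r → 3 ≤ length (vertices r) → ¬ Adj j i
    no-closing-edge r@(step _ _) r! 3≤ a = acyclic (vertices r) (3≤ , r! , vertices-++-linked r a)
    no-closing-edge here _ (s≤s ()) _

  IsLeaf : Fin n → Fin n → Set
  IsLeaf ℓ p = Adj ℓ p × (∀ j → Adj ℓ j → j ≡ p)

  module _ (tree : IsTree G) where
    private
      connected : Connected G
      connected = proj₁ tree
      acyclic : Acyclic G
      acyclic = proj₂ tree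

    -- In a tree i and j are adjacent iff the simple walk between them has exactly two vertices.
    Adj? : ∀ i j → Dec (Adj i j)
    Adj? i j with i ≟ᶠ j
    ... | yes refl = no irrefl
    ... | no i≢j with simplify (connected i j)
    ...   | here , _ = contradiction refl i≢j
    ...   | step {j = m} a r , r! with m ≟ᶠ j
    ...     | yes refl = yes a
    ...     | no m≢j = no (no-closing-edge acyclic (step a r) r! (s≤s (2≤length-vertices r m≢j)) ∘ Adj-sym)

    -- Grow a simple walk at its head u while u has a neighbour off the walk. Once it has none,
    -- acyclicity leaves the next vertex m as its only neighbour. A simple walk has at most n vertices.
    extend-to-leaf : ∀ fuel {u m v} (a : Adj u m) (r : Reachable G m v) → Simple (step a r) →
                     n < fuel + length (vertices (step a r)) → ∃ λ ℓ → ∃ (IsLeaf ℓ)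
    extend-to-leaf zero a r r! n< =
      contradiction (≤-trans (length-unique≤ (Fin-finite n) r!) (≤-reflexive (length-tabulate _))) (<⇒≱ n<)
    extend-to-leaf (suc fuel) {u} {m} a r r!@(u∉r ∷ r′!) n< with any? (λ z → Adj? u z ×-dec ¬? (z ∈? vertices (step a r)))
    ... | yes (z , a′ , z∉) =
      extend-to-leaf fuel (Adj-sym a′) (step a r) (¬Any⇒All¬ _ z∉ ∷ r!) (subst (n <_) (sym (+-suc fuel _)) n<)
    ... | no stuck = u , m , a , only-m
      where
      only-m : ∀ j → Adj u j → j ≡ m
      only-m j a′ with j ∈? vertices (step a r)
      ... | no j∉ = contradiction (j , a′ , j∉) stuck
      ... | yes (here refl) = contradiction a′ irrefl
      ... | yes (there j∈r) with j ≟ᶠ m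
      ...   | yes j≡m = j≡m
      ...   | no j≢m with prefix r r′! j∈r
      ...     | (r″ , r″!) , r″⊆r = contradiction (Adj-sym a′)
                  (no-closing-edge acyclic (step a r″) (All.tabulate (All.lookup u∉r ∘ r″⊆r) ∷ r″!)
                                   (s≤s (2≤length-vertices r″ (j≢m ∘ sym))))

    leaf-exists : ∀ {i j} → i ≢ j → ∃ λ ℓ → ∃ (IsLeaf ℓ)
    leaf-exists {i} {j} i≢j with simplify (connected i j)
    ... | here , _ = contradiction refl i≢j
    ... | step a r , r! = extend-to-leaf n a r r! (m<m+n n (s≤s z≤n))

module LeafRemoval where
  open Walks using (IsLeaf)
  open import Data.Fin.Properties using (punchIn-injective; punchInᵢ≢i; punchIn-punchOut) renaming (_≟_ to _≟ᶠ_)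
  open import Data.List using (map; [_])
  open import Data.List.Properties using (length-map; map-++)
  open import Data.List.Relation.Unary.Linked using (Linked)
  import Data.List.Relation.Unary.Linked.Properties as Linked
  import Data.List.Relation.Unary.Unique.Propositional.Properties as Unique

  data PunchView {m} (ℓ : Fin (suc m)) : Fin (suc m) → Set where
    at : PunchView ℓ ℓ
    punched : ∀ i → PunchView ℓ (punchIn ℓ i)

  punchView : ∀ {m} (ℓ v : Fin (suc m)) → PunchView ℓ v
  punchView ℓ v with ℓ ≟ᶠ v
  ... | yes refl = at
  ... | no ℓ≢v = subst (PunchView ℓ) (punchIn-punchOut ℓ≢v) (punched (punchOut ℓ≢v))

  removeVertex : ∀ {n} → Graph (suc n) → Fin (suc n) → Graph n
  removeVertex G ℓ = record
    { Adj = λ i j → Adj (punchIn ℓ i) (punchIn ℓ j)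
    ; sym = Graph.sym G
    ; irrefl = irrefl
    }
    where open Graph G

  removeVertex-acyclic : ∀ {n} (G : Graph (suc n)) ℓ → Acyclic G → Acyclic (removeVertex G ℓ)
  removeVertex-acyclic G ℓ acyclic (v ∷ vs) (3≤ , vs! , linked) = acyclic (punchIn ℓ v ∷ map (punchIn ℓ) vs)
    ( subst (3 ≤_) (sym (cong suc (length-map (punchIn ℓ) vs))) 3≤
    , Unique.map⁺ (punchIn-injective ℓ _ _) vs!
    , subst (Linked (Graph.Adj G)) (map-++ (punchIn ℓ) (v ∷ vs) [ v ]) (Linked.map⁺ linked) )

  module _ {n} (G : Graph (suc n)) {ℓ p} (leaf : IsLeaf G ℓ p) where
    open Graph G renaming (sym to Adj-sym)
    private
      G′ : Graph n
      G′ = removeVertex G ℓ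

    -- A walk can only enter the leaf ℓ from p and must return to p, so the detour is cut out.
    reachable-avoiding-leaf : ∀ {a b} → Reachable G a b →
                              ∀ i j → punchIn ℓ i ≡ a → punchIn ℓ j ≡ b → Reachable G′ i j
    reachable-avoiding-leaf here i j refl eq = subst (Reachable G′ i) (punchIn-injective ℓ i j (sym eq)) here
    reachable-avoiding-leaf (step {j = m} a r) i j ea eb with ℓ ≟ᶠ m
    reachable-avoiding-leaf (step {j = m} a r) i j refl eb | no ℓ≢m =
      step (subst (Adj (punchIn ℓ i)) (sym (punchIn-punchOut ℓ≢m)) a)
           (reachable-avoiding-leaf r (punchOut ℓ≢m) j (punchIn-punchOut ℓ≢m) eb)
    reachable-avoiding-leaf (step a here) i j ea eb | yes refl = contradiction eb (punchInᵢ≢i ℓ j)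
    reachable-avoiding-leaf (step a (step a′ r)) i j refl eb | yes refl =
      reachable-avoiding-leaf r i j (trans (proj₂ leaf _ (Adj-sym a)) (sym (proj₂ leaf _ a′))) eb

    removeLeaf-tree : IsTree G → IsTree G′
    removeLeaf-tree (connected , acyclic) =
      (λ i j → reachable-avoiding-leaf (connected (punchIn ℓ i) (punchIn ℓ j)) i j refl refl) , removeVertex-acyclic G ℓ acyclic

module Realization {q : ℕ} (F : FiniteField q) (d : ℕ) where
  open NatInequalities
  open FieldArithmetic F using (dot-comm)
  open Walks using (IsLeaf; leaf-exists)
  open LeafRemoval
  open import Data.Nat using (_+_; _*_; _^_; >-nonZero)
  open import Data.Nat.Properties hiding (_≟_)
  open import Data.Fin.Properties using (punchIn-injective) renaming (_≟_ to _≟ᶠ_)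
  open import Data.Vec.Functional using (insertAt; updateAt)
  open import Data.Vec.Functional.Properties using (insertAt-lookup; insertAt-punchIn; updateAt-updates; updateAt-minimal)
  open import Data.List using (filter)
  open import Data.List.Membership.Propositional using (find)
  open import Data.List.Membership.Propositional.Properties using (∈-filter⁻)
  open import Data.List.Relation.Binary.Subset.Propositional using (_⊆_)
  import Data.List.Relation.Unary.Unique.Propositional.Properties as Unique
  open import Function using (const)
  open FiniteField F using (Carrier; 0#)

  V : Set
  V = Vec Carrier d

  Realizes : ∀ {m} (G : Graph m) → (Fin m → FinSubset V) → (Fin m → Fin m → Carrier) → (Fin m → V) → Set
  Realizes G A α x = (∀ i → x i ∈ proj₁ (A i)) × (∀ i j → Graph.Adj G i j → dot F (x i) (x j) ≡ α i j)

  glue-leaf : ∀ {k} (G : Graph (suc (suc k))) {ℓ p} → IsLeaf G ℓ (punchIn ℓ p) →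
              ∀ (A : Fin (suc (suc k)) → FinSubset V) α → (∀ i j → Graph.Adj G i j → α i j ≡ α j i) →
              ∀ {x′ y} → Realizes (removeVertex G ℓ) (A ∘ punchIn ℓ) (λ i j → α (punchIn ℓ i) (punchIn ℓ j)) x′ →
              y ∈ proj₁ (A ℓ) → dot F (x′ p) y ≡ α (punchIn ℓ p) ℓ → Realizes G A α (insertAt x′ ℓ y)
  glue-leaf {k} G {ℓ} {p} (_ , only-p) A α α-sym {x′} {y} (x′∈A , x′-edges) y∈Aℓ x′p·y≡α = ∈A , edges
    where
    open Graph G renaming (sym to Adj-sym)
    x : Fin (suc (suc k)) → V
    x = insertAt x′ ℓ y
    ∈A : ∀ v → x v ∈ proj₁ (A v)
    ∈A v with punchView ℓ v
    ... | at rewrite insertAt-lookup x′ ℓ y = y∈Aℓ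
    ... | punched i rewrite insertAt-punchIn x′ ℓ y i = x′∈A i
    edges : ∀ u v → Adj u v → dot F (x u) (x v) ≡ α u v
    edges u v a with punchView ℓ u | punchView ℓ v
    ... | at | at = contradiction a irrefl
    ... | at | punched j with refl ← punchIn-injective ℓ j p (only-p _ a)
      rewrite insertAt-lookup x′ ℓ y | insertAt-punchIn x′ ℓ y j =
        trans (dot-comm y (x′ j)) (trans x′p·y≡α (α-sym _ _ (Adj-sym a)))
    ... | punched i | at with refl ← punchIn-injective ℓ i p (only-p _ (Adj-sym a))
      rewrite insertAt-lookup x′ ℓ y | insertAt-punchIn x′ ℓ y i = x′p·y≡α
    ... | punched i | punched j rewrite insertAt-punchIn x′ ℓ y i | insertAt-punchIn x′ ℓ y j = x′-edges i j a

  K : ℕ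
  K = 2 * (q * q ^ d + q ^ d)

  module Pruning {m : ℕ} (G : Graph m) (A : Fin m → FinSubset V) (nonempty : ∀ i → 1 ≤ ∣ A i ∣)
                 {p ℓ : Fin m} {t : Carrier} (t≢0 : t ≢ 0#) (K≤pℓ : K ≤ ∣ A p ∣ * ∣ A ℓ ∣) where
    open Graph G using (Adj; irrefl)
    open SecondMoment F t≢0 (proj₁ (A ℓ)) (proj₂ (A ℓ)) using (partner?; half-have-partners)

    partnered : FinSubset V
    partnered = filter partner? (proj₁ (A p)) , Unique.filter⁺ partner? (proj₂ (A p))

    A″ : Fin m → FinSubset V
    A″ = updateAt A p (const partnered)

    A″-p : A″ p ≡ partnered
    A″-p = updateAt-updates p A

    A″-same : ∀ v → v ≢ p → A v ≡ A″ v
    A″-same v v≢p = sym (updateAt-minimal v p A v≢p)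

    A″-half : ∣ A p ∣ ≤ 2 * ∣ A″ p ∣
    A″-half rewrite A″-p = half-have-partners {{>-nonZero (nonempty ℓ)}} (proj₂ (A p)) K≤pℓ

    A″⊆A : ∀ v → proj₁ (A″ v) ⊆ proj₁ (A v)
    A″⊆A v with v ≟ᶠ p
    ... | yes refl rewrite A″-p = proj₁ ∘ ∈-filter⁻ partner?
    ... | no v≢p rewrite A″-same v v≢p = λ x∈A″ → x∈A″

    A″-nonempty : ∀ v → 1 ≤ ∣ A″ v ∣
    A″-nonempty v with v ≟ᶠ p
    ... | yes refl = 1≤2n⇒1≤n (≤-trans (nonempty v) A″-half)
    ... | no v≢p rewrite sym (A″-same v v≢p) = nonempty v

    A″-bound : ∀ {c} → (∀ i j → Adj i j → 2 * c ≤ ∣ A i ∣ * ∣ A j ∣) →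
               ∀ i j → Adj i j → c ≤ ∣ A″ i ∣ * ∣ A″ j ∣
    A″-bound big i j a = *-cancelˡ-≤ 2 (≤-trans (big i j a)
      (size-halving A″-half (λ v v≢p → cong ∣_∣ (A″-same v v≢p)) λ { refl → irrefl a }))

    partner-in-Aℓ : ∀ {x} → x ∈ proj₁ (A″ p) → ∃ λ y → y ∈ proj₁ (A ℓ) × dot F x y ≡ t
    partner-in-Aℓ x∈A″p rewrite A″-p = find (proj₂ (∈-filter⁻ partner? {xs = proj₁ (A p)} x∈A″p))

  element-of-nonempty : ∀ {xs : List V} → 1 ≤ length xs → ∃ (_∈ xs)
  element-of-nonempty {y ∷ _} _ = y , here refl

  realize : ∀ k (G : Graph (suc k)) → IsTree G → (A : Fin (suc k) → FinSubset V) → (∀ i → 1 ≤ ∣ A i ∣) →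
            (∀ i j → Graph.Adj G i j → 2 ^ k * K ≤ ∣ A i ∣ * ∣ A j ∣) →
            ∀ α → (∀ i j → Graph.Adj G i j → α i j ≡ α j i) → (∀ i j → Graph.Adj G i j → α i j ≢ 0#) →
            Σ (Fin (suc k) → V) (Realizes G A α)
  realize zero G _ A nonempty _ α _ _ =
    let y , y∈A0 = element-of-nonempty (nonempty zero)
    in (λ _ → y) , (λ { zero → y∈A0 }) , (λ { zero zero a → contradiction a (Graph.irrefl G) })
  realize (suc k) G tree A nonempty big α α-sym α≢0 with leaf-exists G tree {zero} {suc zero} (λ ())
  ... | ℓ , p , leaf with punchView ℓ p
  ...   | at = contradiction (proj₁ leaf) (Graph.irrefl G)
  ...   | punched p′ = insertAt x′ ℓ y , glue-leaf G leaf A α α-sym realized y∈Aℓ x′p′·y≡t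
    where
    pℓ : Graph.Adj G (punchIn ℓ p′) ℓ
    pℓ = Graph.sym G (proj₁ leaf)
    open Pruning G A nonempty (α≢0 _ _ pℓ) (≤-trans (m≤n*m K (2 ^ suc k) {{m^n≢0 2 (suc k)}}) (big _ _ pℓ))
    α′ : Fin (suc k) → Fin (suc k) → Carrier
    α′ i j = α (punchIn ℓ i) (punchIn ℓ j)
    IH : Σ (Fin (suc k) → V) (Realizes (removeVertex G ℓ) (A″ ∘ punchIn ℓ) α′)
    IH = realize k (removeVertex G ℓ) (removeLeaf-tree G leaf tree) (A″ ∘ punchIn ℓ) (A″-nonempty ∘ punchIn ℓ)
                 (λ _ _ → A″-bound (λ i j a → ≤-trans (≤-reflexive (sym (*-assoc 2 (2 ^ k) K))) (big i j a)) _ _)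
                 α′ (λ _ _ → α-sym _ _) (λ _ _ → α≢0 _ _)
    x′ : Fin (suc k) → V
    x′ = proj₁ IH
    realized : Realizes (removeVertex G ℓ) (A ∘ punchIn ℓ) α′ x′
    realized = (λ i → A″⊆A (punchIn ℓ i) (proj₁ (proj₂ IH) i)) , proj₂ (proj₂ IH)
    partner : ∃ λ y → y ∈ proj₁ (A ℓ) × dot F (x′ p′) y ≡ α (punchIn ℓ p′) ℓ
    partner = partner-in-Aℓ (proj₁ (proj₂ IH) p′)
    y : V
    y = proj₁ partner
    y∈Aℓ : y ∈ proj₁ (A ℓ)
    y∈Aℓ = proj₁ (proj₂ partner)
    x′p′·y≡t : dot F (x′ p′) y ≡ α (punchIn ℓ p′) ℓ
    x′p′·y≡t = proj₂ (proj₂ partner)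

open NatInequalities using (1≤m*n⇒1≤m; 2^k*K≤C*q^e; K-positive)
open FieldArithmetic using (q-nonZero)
open Realization using (realize)
open import Data.Nat using (_*_; _+_; _∸_; _^_)
open import Data.Nat.Properties using (≤-trans)
open import Data.Fin.Properties using (punchInᵢ≢i)

nonempty-vertices : ∀ {m} (G : Graph (suc (suc m))) → Connected G → ∀ {c} (s : Fin (suc (suc m)) → ℕ) →
                    1 ≤ c → (∀ i j → Graph.Adj G i j → c ≤ s i * s j) → ∀ i → 1 ≤ s i
nonempty-vertices G connected s 1≤c big i =
  let j , a = Walks.first-step G (connected i (punchIn i zero)) (punchInᵢ≢i i zero ∘ sym)
  in 1≤m*n⇒1≤m (≤-trans 1≤c (big i j a))

theorem4 : (k : ℕ) → 2 ≤ k →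
    Σ ℕ λ C →
      (d : ℕ) → 1 ≤ d →
      (q : ℕ) (F : FiniteField q) →
      (G : Graph (suc k)) → IsTree G →
      (A : Fin (suc k) → FinSubset (Vec (FiniteField.Carrier F) d)) →
      (∀ i j → Graph.Adj G i j → C * q ^ (d + k ∸ 1) ≤ ∣ A i ∣ * ∣ A j ∣) →
      (α : Fin (suc k) → Fin (suc k) → FiniteField.Carrier F) →
      (∀ i j → Graph.Adj G i j → α i j ≡ α j i) →
      (∀ i j → Graph.Adj G i j → ¬ (α i j ≡ FiniteField.0# F)) →
      Σ (Fin (suc k) → Vec (FiniteField.Carrier F) d) λ x →
        (∀ i → x i ∈ proj₁ (A i)) ×
        (∀ i j → Graph.Adj G i j → dot F (x i) (x j) ≡ α i j)
-- The argument works in every dimension.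
theorem4 (suc (suc m)) (s≤s (s≤s z≤n)) = 4 * 2 ^ suc (suc m) , λ d _ q F G tree A big α α-sym α≢0 →
  let big′ i j a = ≤-trans (2^k*K≤C*q^e q d m {{q-nonZero F}}) (big i j a)
      nonempty = nonempty-vertices G (proj₁ tree) (λ i → ∣ A i ∣) (K-positive q d (suc (suc m)) {{q-nonZero F}}) big′
  in realize F d (suc (suc m)) G tree A nonempty big′ α α-sym α≢0
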